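{- Let $E$ be a finite set, $\mathcal{L}$ a set of subsets of $E$, and suppose $T(\mathcal{L})$ acts transitively on $\mathcal{L}$. Fix a system of blocks for $T(\mathcal{L})$. Let $E_1=\{x\in E:\tau_x\text{ is type 1}\}$, $E_2=\{y\in E:\tau_y\text{ is type 2}\}$, and $\mathcal{L}_i=\{A\cap E_i: A\in\mathcal{L}\}$ for $i=1,2$. Suppose that every product $\sigma$ of type 1 toggles has the property that if $\sigma(\mathcal{B})=\mathcal{B}$ for some block $\mathcal{B}$, then $\sigma(A)=A$ for all $A\in\mathcal{B}$. Then $\mathcal{L}=\mathcal{L}_1\otimes\mathcal{L}_2$, where $|\mathcal{L}_1|$ equals the number of blocks and $|\mathcal{L}_2|$ equals the size of each block.
   Context: For $e\in E$, the toggle $\tau_e:\mathcal{L}\to\mathcal{L}$ is defined by $\tau_e(X)=X\triangle\{e\}$ if $X\triangle\{e\}\in\mathcal{L}$, and $\tau_e(X)=X$ otherwise. The toggle group $T(\mathcal{L})$ is the subgroup of the symmetric group on $\mathcal{L}$ generated by $\{\tau_e: e\in E\}$. Convention: every $e\in E$ for which $\tau_e$ is the identity permutation is removed from $E$. A block for $T(\mathcal{L})$ is a subset $\mathcal{B}\subseteq\mathcal{L}$ such that for every $g\in T(\mathcal{L})$ either $g(\mathcal{B})=\mathcal{B}$ or $g(\mathcal{B})\cap\mathcal{B}=\emptyset$; a system of blocks is the partition $\{g(\mathcal{B}):g\in T(\mathcal{L})\}$ of $\mathcal{L}$ for a block $\mathcal{B}$. Relative to the fixed block system, an element $g\in T(\mathcal{L})$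 (in particular a toggle) is type 2 if $g(\mathcal{B})=\mathcal{B}$ for every block $\mathcal{B}$ of the system, and type 1 otherwise. For disjoint finite sets $E_1,E_2$ and $\mathcal{L}_i\subseteq 2^{E_i}$, the toggle-disjoint Cartesian product is $\mathcal{L}_1\otimes\mathcal{L}_2=\{X_1\cup X_2: X_1\in\mathcal{L}_1, X_2\in\mathcal{L}_2\}$. -}

module Defs where

open import Data.Nat using (ℕ)
open import Data.Bool using (Bool; true; false; not; if_then_else_; T)
open import Data.Fin using (Fin)
open import Data.Fin.Subset using (Subset; _∈_; _∪_)
open import Data.Vec using (Vec; lookup; updateAt)
open import Data.List using (List; []; _∷_; [_])
open import Data.List.Relation.Unary.All using (All)
open import Data.Product using (Σ; ∃; _×_; _,_)
open import Data.Sum using (_⊎_)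
open import Data.Empty using (⊥)
open import Relation.Nullary using (¬_)
open import Relation.Binary.PropositionalEquality using (_≡_)

-- E = Fin n; a family 𝓛 ⊆ 2^E is a decidable (Bool-valued) predicate on Subset n.
Family : ℕ → Set
Family n = Subset n → Bool

Coll : ℕ → Set₁
Coll n = Subset n → Set

_⇔_ : Set → Set → Set
A ⇔ B = (A → B) × (B → A)

module _ {n : ℕ} (L : Family n) where

  flipAt : Fin n → Subset n → Subset n
  flipAt e X = updateAt X e not

  toggle : Fin n → Subset n → Subset n
  toggle e X = if L (flipAt e X) then flipAt e X else X

  -- elements of T(𝓛) are represented by words in the toggles
  -- (every τ_e is an involution, so these are all group elements);
  -- act (e₁ ∷ … ∷ eₖ) = τ_{e₁} ∘ … ∘ τ_{eₖ}
  act : List (Fin n) → Subset n → Subset n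
  act [] X = X
  act (e ∷ w) X = toggle e (act w X)

  NontrivialToggle : Fin n → Set
  NontrivialToggle e = Σ (Subset n) λ X → T (L X) × ¬ (toggle e X ≡ X)

  Transitive : Set
  Transitive = ∀ X Y → T (L X) → T (L Y) → Σ (List (Fin n)) λ g → act g X ≡ Y

  Img : List (Fin n) → Coll n → Coll n
  Img g C X = Σ (Subset n) λ Y → C Y × act g Y ≡ X

  SetEq : Coll n → Coll n → Set
  SetEq C D = ∀ X → C X ⇔ D X

  Disjoint : Coll n → Coll n → Set
  Disjoint C D = ∀ X → C X → D X → ⊥

  IsBlock : Coll n → Set
  IsBlock B = (∀ X → B X → T (L X))
            × (Σ (Subset n) B)
            × (∀ g → SetEq (Img g B) B ⊎ Disjoint (Img g B) B)

  -- relative to the block system {h(B)}: g is type 2 if it fixes every block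
  Type2 : Coll n → List (Fin n) → Set
  Type2 B g = ∀ h → SetEq (Img g (Img h B)) (Img h B)

  Type1 : Coll n → List (Fin n) → Set
  Type1 B g = ¬ Type2 B g

  Restr : (Fin n → Set) → Subset n → Subset n → Set
  Restr P A Y = ∀ e → (e ∈ Y) ⇔ ((e ∈ A) × P e)

  Proj : (Fin n → Set) → Coll n
  Proj P Y = Σ (Subset n) λ A → T (L A) × Restr P A Y

  E₁ : Coll n → Fin n → Set
  E₁ B x = Type1 B [ x ]

  E₂ : Coll n → Fin n → Set
  E₂ B y = Type2 B [ y ]

  IsProduct : Coll n → Coll n → Set
  IsProduct L₁ L₂ = ∀ X → T (L X) ⇔
    (Σ (Subset n) λ X₁ → Σ (Subset n) λ X₂ → L₁ X₁ × L₂ X₂ × X ≡ X₁ ∪ X₂)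

  NumBlocks : Coll n → ℕ → Set
  NumBlocks B m = Σ (Vec (List (Fin n)) m) λ hs →
      (∀ i j → SetEq (Img (lookup hs i) B) (Img (lookup hs j) B) → i ≡ j)
    × (∀ h → Σ (Fin m) λ i → SetEq (Img h B) (Img (lookup hs i) B))

HasSize : {n : ℕ} → Coll n → ℕ → Set
HasSize {n} C m = Σ (Vec (Subset n) m) λ v →
    (∀ i j → lookup v i ≡ lookup v j → i ≡ j)
  × (∀ X → C X ⇔ (Σ (Fin m) λ i → lookup v i ≡ X))

-- Type-1 and type-2 toggles commute on 𝓛: a type-1 toggle that moves one element of a
-- block moves all of them (otherwise, by the hypothesis, it would fix the block pointwise),
-- while a type-2 toggle keeps every element in its block.  Hence every element of T(𝓛)
-- factors as a type-1 word after a type-2 word.  Type-2 words stay inside a block and only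
-- change coordinates in E₂; type-1 words only change coordinates in E₁ and fix pointwise
-- every block they stabilise.  So two members of 𝓛 lie in the same block iff they agree
-- on E₁, and the E₁-part of any member of 𝓛 combines with the E₂-part of any other into a
-- member of 𝓛.  Blocks therefore correspond to 𝓛₁, each block is in bijection with 𝓛₂,
-- and 𝓛 = 𝓛₁ ⊗ 𝓛₂.
module Submission where

open import Defs
open import Data.Nat using (ℕ; zero; suc)
open import Data.Bool using (true; false; not; T; _∧_; _∨_)
open import Data.Bool.Properties
  using (not-involutive; not-¬; ∧-identityʳ; ∧-zeroʳ; ∨-identityʳ; T?)
  renaming (_≟_ to _≟ᵇ_)
open import Data.Fin using (Fin; zero; suc)
open import Data.Fin.Subset using (Subset; inside; outside; _∈_; _∩_; _∪_)
open import Data.Fin.Subset.Properties using (anySubset?; ⊆-antisym; x∈p∩q⁺; x∈p∩q⁻)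
open import Data.Vec using (Vec; []; _∷_; lookup; updateAt; tabulate)
open import Data.Vec.Properties
  using (≡-dec; lookup∘tabulate; lookup-zipWith; lookup∘updateAt; lookup∘updateAt′;
         updateAt-updateAt-local; updateAt-id; updateAt-commutes; []=⇒lookup; lookup⇒[]=)
open import Data.Vec.Relation.Binary.Pointwise.Extensional using (ext; Pointwise-≡⇒≡)
open import Data.List using (List; []; _∷_; [_]; _++_; map; reverse)
open import Data.List.Properties using (unfold-reverse; reverse-involutive)
open import Data.List.Relation.Unary.All using (All; []; _∷_)
import Data.List.Relation.Unary.All as All
open import Data.List.Relation.Unary.Any using (here; there)
open import Data.List.Membership.Propositional using () renaming (_∈_ to _∈ˡ_)
open import Data.List.Membership.Propositional.Properties using (∈-map⁺; ∈-++⁺ˡ; ∈-++⁺ʳ)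
open import Data.Product using (Σ; ∃; _×_; _,_; proj₁; proj₂)
open import Data.Sum using (_⊎_; inj₁; inj₂)
open import Data.Empty using (⊥-elim)
open import Data.Unit using (tt)
open import Function using (_∘_)
open import Relation.Nullary using (¬_; Dec; yes; no; does)
open import Relation.Nullary.Decidable using (map′; ¬?; dec-true; dec-false; decidable-stable; _×-dec_; _→-dec_)
open import Relation.Unary using (Decidable)
open import Relation.Binary.PropositionalEquality
  using (_≡_; _≢_; refl; sym; trans; cong; cong₂; subst; module ≡-Reasoning)

open ≡-Reasoning

private
  variable
    n m : ℕ

AgreeOn : (Fin n → Set) → Subset n → Subset n → Set
AgreeOn P X Y = ∀ {e} → P e → lookup X e ≡ lookup Y e

≡-from-agreement : {P : Fin n → Set} → Decidable P → {X Y : Subset n}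
                 → AgreeOn P X Y → AgreeOn (¬_ ∘ P) X Y → X ≡ Y
≡-from-agreement {P = P} P? {X} {Y} on off = Pointwise-≡⇒≡ (ext λ e → by-cases e (P? e))
  where
  by-cases : ∀ e → Dec (P e) → lookup X e ≡ lookup Y e
  by-cases e (yes p) = on p
  by-cases e (no ¬p) = off ¬p

lookup-∪ : ∀ (X Y : Subset n) e → lookup (X ∪ Y) e ≡ lookup X e ∨ lookup Y e
lookup-∪ X Y e = lookup-zipWith _∨_ e X Y

flip-involutive : ∀ e (X : Subset n) → updateAt (updateAt X e not) e not ≡ X
flip-involutive e X =
  trans (updateAt-updateAt-local e X (not-involutive (lookup X e))) (updateAt-id e X)

flip-moves : ∀ e (X : Subset n) → updateAt X e not ≢ X
flip-moves e X eq =
  not-¬ refl (sym (trans (sym (lookup∘updateAt e X)) (cong (λ Z → lookup Z e) eq)))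

allSubsets : ∀ n → List (Subset n)
allSubsets zero = [ [] ]
allSubsets (suc n) = map (inside ∷_) (allSubsets n) ++ map (outside ∷_) (allSubsets n)

∈-allSubsets : (X : Subset n) → X ∈ˡ allSubsets n
∈-allSubsets [] = here refl
∈-allSubsets {suc n} (inside ∷ X) = ∈-++⁺ˡ (∈-map⁺ (inside ∷_) (∈-allSubsets X))
∈-allSubsets {suc n} (outside ∷ X) =
  ∈-++⁺ʳ (map (inside ∷_) (allSubsets n)) (∈-map⁺ (outside ∷_) (∈-allSubsets X))

allSubset? : {P : Subset n → Set} → Decidable P → Dec (∀ X → P X)
allSubset? P? with anySubset? (¬? ∘ P?)
... | yes (X , ¬px) = no (λ all → ¬px (all X))
... | no ∄¬px = yes (λ X → decidable-stable (P? X) (λ ¬px → ∄¬px (X , ¬px)))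

HasSize-cong : {C D : Coll n} → (∀ X → C X ⇔ D X) → HasSize C m → HasSize D m
HasSize-cong C⇔D (v , v-inj , v-enum) =
  v , v-inj , λ X → (proj₁ (v-enum X) ∘ proj₂ (C⇔D X)) , (proj₁ (C⇔D X) ∘ proj₂ (v-enum X))

HasSize-cons : {C : Coll n} {x : Subset n} → HasSize C m → ¬ C x
             → HasSize (λ X → x ≡ X ⊎ C X) (suc m)
HasSize-cons {m = m} {C = C} {x = x} (v , v-inj , v-enum) x∉C = x ∷ v , inj , enum
  where
  v∈C : ∀ i → C (lookup v i)
  v∈C i = proj₂ (v-enum _) (i , refl)
  inj : ∀ i j → lookup (x ∷ v) i ≡ lookup (x ∷ v) j → i ≡ j
  inj zero    zero    _  = refl
  inj zero    (suc j) eq = ⊥-elim (x∉C (subst C (sym eq) (v∈C j)))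
  inj (suc i) zero    eq = ⊥-elim (x∉C (subst C eq (v∈C i)))
  inj (suc i) (suc j) eq = cong suc (v-inj i j eq)
  enum : ∀ X → (x ≡ X ⊎ C X) ⇔ (Σ (Fin (suc m)) λ i → lookup (x ∷ v) i ≡ X)
  enum X = to , from
    where
    to : x ≡ X ⊎ C X → Σ (Fin (suc m)) λ i → lookup (x ∷ v) i ≡ X
    to (inj₁ x≡X) = zero , x≡X
    to (inj₂ X∈C) with proj₁ (v-enum X) X∈C
    ... | i , eq = suc i , eq
    from : (Σ (Fin (suc m)) λ i → lookup (x ∷ v) i ≡ X) → x ≡ X ⊎ C X
    from (zero  , eq) = inj₁ eq
    from (suc i , eq) = inj₂ (proj₂ (v-enum X) (i , eq))

HasSize-map : {C D : Coll n} (f : Subset n → Subset n)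
            → (∀ {Y} → C Y → D (f Y))
            → (∀ {X} → D X → Σ (Subset n) λ Y → C Y × f Y ≡ X)
            → (∀ {Y Y′} → C Y → C Y′ → f Y ≡ f Y′ → Y ≡ Y′)
            → HasSize C m → HasSize D m
HasSize-map {n = n} {m = m} {C = C} {D = D} f f∈D f-onto f-inj (v , v-inj , v-enum) = w , w-inj , w-enum
  where
  w : Vec (Subset n) m
  w = tabulate (f ∘ lookup v)
  v∈C : ∀ i → C (lookup v i)
  v∈C i = proj₂ (v-enum (lookup v i)) (i , refl)
  w-inj : ∀ i j → lookup w i ≡ lookup w j → i ≡ j
  w-inj i j eq = v-inj i j (f-inj (v∈C i) (v∈C j)
    (trans (sym (lookup∘tabulate _ i)) (trans eq (lookup∘tabulate _ j))))
  w-enum : ∀ X → D X ⇔ (Σ (Fin m) λ i → lookup w i ≡ X)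
  w-enum X = to , from
    where
    to : D X → Σ (Fin m) λ i → lookup w i ≡ X
    to X∈D with f-onto X∈D
    ... | Y , Y∈C , fY≡X with proj₁ (v-enum Y) Y∈C
    ... | i , vi≡Y = i , trans (lookup∘tabulate _ i) (trans (cong f vi≡Y) fY≡X)
    from : (Σ (Fin m) λ i → lookup w i ≡ X) → D X
    from (i , eq) = subst D (trans (sym (lookup∘tabulate _ i)) eq) (f∈D (v∈C i))

module _ {C : Coll n} (C? : Decidable C) where
  open import Data.List.Membership.DecPropositional (≡-dec {n = n} _≟ᵇ_) using (_∈?_)

  private
    within-cons-new : ∀ {x l} → C x → ∀ X → (x ≡ X ⊎ (C X × X ∈ˡ l)) ⇔ (C X × X ∈ˡ x ∷ l)
    within-cons-new x∈C X =
      (λ { (inj₁ refl) → x∈C , here refl ; (inj₂ (X∈C , X∈l)) → X∈C , there X∈l })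
      , (λ { (X∈C , here refl) → inj₁ refl ; (X∈C , there X∈l) → inj₂ (X∈C , X∈l) })

    within-cons-old : ∀ {x l} → (C x → x ∈ˡ l) → ∀ X → (C X × X ∈ˡ l) ⇔ (C X × X ∈ˡ x ∷ l)
    within-cons-old x∈C⇒x∈l X =
      (λ { (X∈C , X∈l) → X∈C , there X∈l })
      , (λ { (X∈C , here refl) → X∈C , x∈C⇒x∈l X∈C ; (X∈C , there X∈l) → X∈C , X∈l })

    HasSize-within : ∀ l → ∃ λ m → HasSize (λ X → C X × X ∈ˡ l) m
    HasSize-within [] = 0 , [] , (λ ()) , λ X → (λ { (_ , ()) }) , λ { (() , _) }
    HasSize-within (x ∷ l) with C? x | x ∈? l | HasSize-within l
    ... | yes x∈C | no x∉l | m , size =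
      suc m , HasSize-cong (within-cons-new x∈C) (HasSize-cons size (x∉l ∘ proj₂))
    ... | yes _ | yes x∈l | m , size = m , HasSize-cong (within-cons-old (λ _ → x∈l)) size
    ... | no x∉C | _ | m , size = m , HasSize-cong (within-cons-old (⊥-elim ∘ x∉C)) size

  decidable⇒HasSize : ∃ λ m → HasSize C m
  decidable⇒HasSize with HasSize-within (allSubsets n)
  ... | m , size = m , HasSize-cong (λ X → proj₁ , (λ X∈C → X∈C , ∈-allSubsets X)) size

Restr-unique : ∀ {L : Family n} {P A Y Y′} → Restr L P A Y → Restr L P A Y′ → Y ≡ Y′
Restr-unique r r′ =
  ⊆-antisym (λ {e} e∈Y → proj₂ (r′ e) (proj₁ (r e) e∈Y)) (λ {e} e∈Y′ → proj₂ (r e) (proj₁ (r′ e) e∈Y′))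

module Restriction (L : Family n) {P : Fin n → Set} (P? : Decidable P) where

  ⟦P⟧ : Subset n
  ⟦P⟧ = tabulate (does ∘ P?)

  restrict : Subset n → Subset n
  restrict A = A ∩ ⟦P⟧

  lookup-⟦P⟧ : ∀ e → lookup ⟦P⟧ e ≡ does (P? e)
  lookup-⟦P⟧ = lookup∘tabulate (does ∘ P?)

  ∈⟦P⟧⁻ : ∀ {e} → e ∈ ⟦P⟧ → P e
  ∈⟦P⟧⁻ {e} e∈P with P? e | trans (sym ([]=⇒lookup e∈P)) (lookup-⟦P⟧ e)
  ... | yes p | _ = p
  ... | no _ | ()

  ∈⟦P⟧⁺ : ∀ {e} → P e → e ∈ ⟦P⟧
  ∈⟦P⟧⁺ {e} p = lookup⇒[]= e ⟦P⟧ (trans (lookup-⟦P⟧ e) (dec-true (P? e) p))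

  restrict-agrees : ∀ A → AgreeOn P (restrict A) A
  restrict-agrees A {e} p = begin
    lookup (A ∩ ⟦P⟧) e          ≡⟨ lookup-zipWith _∧_ e A ⟦P⟧ ⟩
    lookup A e ∧ lookup ⟦P⟧ e   ≡⟨ cong (lookup A e ∧_) (trans (lookup-⟦P⟧ e) (dec-true (P? e) p)) ⟩
    lookup A e ∧ true           ≡⟨ ∧-identityʳ _ ⟩
    lookup A e                  ∎

  restrict-outside : ∀ A {e} → ¬ P e → lookup (restrict A) e ≡ false
  restrict-outside A {e} ¬p = begin
    lookup (A ∩ ⟦P⟧) e          ≡⟨ lookup-zipWith _∧_ e A ⟦P⟧ ⟩
    lookup A e ∧ lookup ⟦P⟧ e   ≡⟨ cong (lookup A e ∧_) (trans (lookup-⟦P⟧ e) (dec-false (P? e) ¬p)) ⟩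
    lookup A e ∧ false          ≡⟨ ∧-zeroʳ _ ⟩
    false                       ∎

  restrict-Restr : ∀ A → Restr L P A (restrict A)
  restrict-Restr A e =
      (λ e∈A∩P → let (e∈A , e∈P) = x∈p∩q⁻ A ⟦P⟧ e∈A∩P in e∈A , ∈⟦P⟧⁻ e∈P)
    , (λ (e∈A , p) → x∈p∩q⁺ (e∈A , ∈⟦P⟧⁺ p))

  restrict∈Proj : ∀ {A} → T (L A) → Proj L P (restrict A)
  restrict∈Proj {A} A∈L = A , A∈L , restrict-Restr A

  Restr⇒≡restrict : ∀ {A Y} → Restr L P A Y → Y ≡ restrict A
  Restr⇒≡restrict {A} r = Restr-unique {L = L} r (restrict-Restr A)

  Proj-outside : ∀ {Y e} → Proj L P Y → ¬ P e → lookup Y e ≡ false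
  Proj-outside {e = e} (A , _ , r) ¬p =
    trans (cong (λ Z → lookup Z e) (Restr⇒≡restrict r)) (restrict-outside A ¬p)

  restrict-cong : ∀ {A A′} → AgreeOn P A A′ → restrict A ≡ restrict A′
  restrict-cong {A} {A′} A≈A′ = ≡-from-agreement P?
    (λ p → trans (restrict-agrees A p) (trans (A≈A′ p) (sym (restrict-agrees A′ p))))
    (λ ¬p → trans (restrict-outside A ¬p) (sym (restrict-outside A′ ¬p)))

  restrict-≡⇒agree : ∀ {A A′} → restrict A ≡ restrict A′ → AgreeOn P A A′
  restrict-≡⇒agree {A} {A′} eq {e} p =
    trans (sym (restrict-agrees A p)) (trans (cong (λ Z → lookup Z e) eq) (restrict-agrees A′ p))

  Proj? : Decidable (Proj L P)
  Proj? Y with anySubset? (λ A → T? (L A) ×-dec (≡-dec _≟ᵇ_ (restrict A) Y))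
  ... | yes (A , A∈L , refl) = yes (restrict∈Proj A∈L)
  ... | no ∄A = no (λ (A , A∈L , r) → ∄A (A , A∈L , sym (Restr⇒≡restrict r)))

module Toggles (L : Family n) where

  toggle-flips : ∀ {e X} → T (L (flipAt L e X)) → toggle L e X ≡ flipAt L e X
  toggle-flips {e} {X} X△e∈L with L (flipAt L e X)
  ... | true = refl

  toggle-stays : ∀ {e X} → ¬ T (L (flipAt L e X)) → toggle L e X ≡ X
  toggle-stays {e} {X} X△e∉L with L (flipAt L e X)
  ... | true = ⊥-elim (X△e∉L tt)
  ... | false = refl

  toggle-preserves-L : ∀ e {X} → T (L X) → T (L (toggle L e X))
  toggle-preserves-L e {X} X∈L with T? (L (flipAt L e X))
  ... | yes X△e∈L = subst (T ∘ L) (sym (toggle-flips X△e∈L)) X△e∈L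
  ... | no X△e∉L = subst (T ∘ L) (sym (toggle-stays X△e∉L)) X∈L

  toggle-involutive : ∀ e {X} → T (L X) → toggle L e (toggle L e X) ≡ X
  toggle-involutive e {X} X∈L with T? (L (flipAt L e X))
  ... | no X△e∉L = trans (cong (toggle L e) (toggle-stays X△e∉L)) (toggle-stays X△e∉L)
  ... | yes X△e∈L = begin
    toggle L e (toggle L e X)              ≡⟨ cong (toggle L e) (toggle-flips X△e∈L) ⟩
    toggle L e (flipAt L e X)              ≡⟨ toggle-flips (subst (T ∘ L) (sym X△e△e≡X) X∈L) ⟩
    flipAt L e (flipAt L e X)              ≡⟨ X△e△e≡X ⟩
    X                                      ∎
    where
    X△e△e≡X : flipAt L e (flipAt L e X) ≡ X
    X△e△e≡X = flip-involutive e X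

  lookup-toggle : ∀ {e x} X → e ≢ x → lookup (toggle L x X) e ≡ lookup X e
  lookup-toggle {e} {x} X e≢x with T? (L (flipAt L x X))
  ... | yes X△x∈L = trans (cong (λ Z → lookup Z e) (toggle-flips X△x∈L)) (lookup∘updateAt′ e x e≢x X)
  ... | no X△x∉L = cong (λ Z → lookup Z e) (toggle-stays X△x∉L)

  act-preserves-L : ∀ g {X} → T (L X) → T (L (act L g X))
  act-preserves-L []      X∈L = X∈L
  act-preserves-L (e ∷ g) X∈L = toggle-preserves-L e (act-preserves-L g X∈L)

  act-++ : ∀ g h X → act L (g ++ h) X ≡ act L g (act L h X)
  act-++ []      h X = refl
  act-++ (e ∷ g) h X = cong (toggle L e) (act-++ g h X)

  act-reverse-cancel : ∀ g {X} → T (L X) → act L (reverse g) (act L g X) ≡ X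
  act-reverse-cancel []      X∈L = refl
  act-reverse-cancel (e ∷ g) {X} X∈L = begin
    act L (reverse (e ∷ g)) (act L (e ∷ g) X)     ≡⟨ cong (λ w → act L w (act L (e ∷ g) X)) (unfold-reverse e g) ⟩
    act L (reverse g ++ [ e ]) (act L (e ∷ g) X)  ≡⟨ act-++ (reverse g) [ e ] _ ⟩
    act L (reverse g) (toggle L e (toggle L e (act L g X)))
                                                   ≡⟨ cong (act L (reverse g)) (toggle-involutive e (act-preserves-L g X∈L)) ⟩
    act L (reverse g) (act L g X)                  ≡⟨ act-reverse-cancel g X∈L ⟩
    X                                              ∎

  act-cancel-reverse : ∀ g {X} → T (L X) → act L g (act L (reverse g) X) ≡ X
  act-cancel-reverse g {X} X∈L =
    subst (λ w → act L w (act L (reverse g) X) ≡ X) (reverse-involutive g)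
      (act-reverse-cancel (reverse g) X∈L)

  lookup-act-avoiding : ∀ {e} g X → All (e ≢_) g → lookup (act L g X) e ≡ lookup X e
  lookup-act-avoiding []      X []           = refl
  lookup-act-avoiding (x ∷ g) X (e≢x ∷ e∉g) =
    trans (lookup-toggle (act L g X) e≢x) (lookup-act-avoiding g X e∉g)

module BlockSystem (L : Family n) (B : Coll n) (L-transitive : Transitive L) (B-block : IsBlock L B) where

  open Toggles L

  B⊆L : ∀ {X} → B X → T (L X)
  B⊆L = proj₁ B-block _

  base : Subset n
  base = proj₁ (proj₁ (proj₂ B-block))

  base∈B : B base
  base∈B = proj₂ (proj₁ (proj₂ B-block))

  block-property : ∀ g → SetEq L (Img L g B) B ⊎ Disjoint L (Img L g B) B
  block-property = proj₂ (proj₂ B-block)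

  Img⊆L : ∀ h {X} → Img L h B X → T (L X)
  Img⊆L h (Y , Y∈B , refl) = act-preserves-L h (B⊆L Y∈B)

  base∈Img : ∀ h → Img L h B (act L h base)
  base∈Img h = base , base∈B , refl

  Img-∘ : ∀ g h → SetEq L (Img L g (Img L h B)) (Img L (g ++ h) B)
  Img-∘ g h X =
      (λ { (_ , (Y , Y∈B , refl) , refl) → Y , Y∈B , act-++ g h Y })
    , (λ { (Y , Y∈B , refl) → act L h Y , (Y , Y∈B , refl) , sym (act-++ g h Y) })

  images-meet⇒SetEq : ∀ g h {X} → Img L g B X → Img L h B X → SetEq L (Img L g B) (Img L h B)
  images-meet⇒SetEq g h {X} (Y₁ , Y₁∈B , gY₁≡X) (Y₂ , Y₂∈B , hY₂≡X)
    with block-property (reverse h ++ g)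
  ... | inj₂ disjoint = ⊥-elim (disjoint Y₂ (Y₁ , Y₁∈B , kY₁≡Y₂) Y₂∈B)
    where
    kY₁≡Y₂ : act L (reverse h ++ g) Y₁ ≡ Y₂
    kY₁≡Y₂ = begin
      act L (reverse h ++ g) Y₁          ≡⟨ act-++ (reverse h) g Y₁ ⟩
      act L (reverse h) (act L g Y₁)     ≡⟨ cong (act L (reverse h)) (trans gY₁≡X (sym hY₂≡X)) ⟩
      act L (reverse h) (act L h Y₂)     ≡⟨ act-reverse-cancel h (B⊆L Y₂∈B) ⟩
      Y₂                                 ∎
  ... | inj₁ k[B]≡B = λ Z → to , from
    where
    h∘k≡g : ∀ {Y} → T (L Y) → act L h (act L (reverse h ++ g) Y) ≡ act L g Y
    h∘k≡g {Y} Y∈L = trans (cong (act L h) (act-++ (reverse h) g Y))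
                          (act-cancel-reverse h (act-preserves-L g Y∈L))
    to : ∀ {Z} → Img L g B Z → Img L h B Z
    to (Y , Y∈B , refl) = act L (reverse h ++ g) Y , proj₁ (k[B]≡B _) (Y , Y∈B , refl) , h∘k≡g (B⊆L Y∈B)
    from : ∀ {Z} → Img L h B Z → Img L g B Z
    from (Y , Y∈B , refl) with proj₂ (k[B]≡B Y) Y∈B
    ... | Y′ , Y′∈B , refl = Y′ , Y′∈B , sym (h∘k≡g (B⊆L Y′∈B))

  image-stabilised : ∀ g h {X} → Img L h B X → Img L h B (act L g X)
                   → SetEq L (Img L g (Img L h B)) (Img L h B)
  image-stabilised g h (Y , Y∈B , refl) gX∈h[B] Z =
      (λ Z∈g[h[B]] → proj₁ (g∘h[B]≡h[B] Z) (proj₁ (Img-∘ g h Z) Z∈g[h[B]]))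
    , (λ Z∈h[B] → proj₂ (Img-∘ g h Z) (proj₂ (g∘h[B]≡h[B] Z) Z∈h[B]))
    where
    g∘h[B]≡h[B] : SetEq L (Img L (g ++ h) B) (Img L h B)
    g∘h[B]≡h[B] = images-meet⇒SetEq (g ++ h) h (Y , Y∈B , act-++ g h Y) gX∈h[B]

  -- A word carrying the base point of B to X; the junk value [] when X ∉ 𝓛.
  reach : Subset n → List (Fin n)
  reach X with T? (L X)
  ... | yes X∈L = proj₁ (L-transitive base X (B⊆L base∈B) X∈L)
  ... | no _ = []

  ∈-Img-reach : ∀ {X} → T (L X) → Img L (reach X) B X
  ∈-Img-reach {X} X∈L with T? (L X)
  ... | yes X∈L′ = base , base∈B , proj₂ (L-transitive base X (B⊆L base∈B) X∈L′)
  ... | no X∉L = ⊥-elim (X∉L X∈L)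

  B? : Decidable B
  B? X with T? (L X)
  ... | no X∉L = no (X∉L ∘ B⊆L)
  ... | yes X∈L with block-property (reach X)
  ...   | inj₁ reach[B]≡B = yes (proj₁ (reach[B]≡B X) (∈-Img-reach X∈L))
  ...   | inj₂ disjoint = no (disjoint X (∈-Img-reach X∈L))

  Img? : ∀ h → Decidable (Img L h B)
  Img? h X = anySubset? (λ Y → B? Y ×-dec ≡-dec _≟ᵇ_ (act L h Y) X)

  type2-preserves-Img : ∀ {e} → E₂ L B e → ∀ h {X} → Img L h B X → Img L h B (toggle L e X)
  type2-preserves-Img {e} e-type2 h {X} X∈h[B] = proj₁ (e-type2 h (toggle L e X)) (X , X∈h[B] , refl)

  -- A criterion quantifying over subsets only, which makes the type of a toggle decidable.
  type2⇔keeps-blocks : ∀ {e} → E₂ L B e ⇔ (∀ X → T (L X) → Img L (reach X) B (toggle L e X))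
  type2⇔keeps-blocks {e} =
      (λ e-type2 X X∈L → type2-preserves-Img e-type2 (reach X) (∈-Img-reach X∈L))
    , (λ keeps h → image-stabilised [ e ] h (base∈Img h) (keeps-h[B] keeps h))
    where
    keeps-h[B] : (∀ X → T (L X) → Img L (reach X) B (toggle L e X))
               → ∀ h → Img L h B (toggle L e (act L h base))
    keeps-h[B] keeps h =
      proj₁ (images-meet⇒SetEq (reach X) h (∈-Img-reach X∈L) (base∈Img h) (toggle L e X)) (keeps X X∈L)
      where
      X : Subset n
      X = act L h base
      X∈L : T (L X)
      X∈L = Img⊆L h (base∈Img h)

  type2? : Decidable (E₂ L B)
  type2? e = map′ (proj₂ type2⇔keeps-blocks) (proj₁ type2⇔keeps-blocks)
    (allSubset? (λ X → T? (L X) →-dec Img? (reach X) (toggle L e X)))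

module TypeSplit (L : Family n) (B : Coll n) (L-transitive : Transitive L) (B-block : IsBlock L B)
  (type1-stabiliser-fixes : ∀ σ → All (E₁ L B) σ → ∀ h → SetEq L (Img L σ (Img L h B)) (Img L h B)
                          → ∀ A → Img L h B A → act L σ A ≡ A)
  where

  open Toggles L
  open BlockSystem L B L-transitive B-block

  type1≢type2 : ∀ {x y} → E₁ L B x → E₂ L B y → x ≢ y
  type1≢type2 x-type1 y-type2 refl = x-type1 y-type2

  type1-word-fixes-Img : ∀ {σ} → All (E₁ L B) σ → ∀ h {X A} → Img L h B X → Img L h B (act L σ X)
                       → Img L h B A → act L σ A ≡ A
  type1-word-fixes-Img {σ} σ-type1 h {A = A} X∈h[B] σX∈h[B] =
    type1-stabiliser-fixes σ σ-type1 h (image-stabilised σ h X∈h[B] σX∈h[B]) A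

  -- If τₓ fixed Y, the word [x] would stabilise h(B) and hence fix X as well.
  type1-flip-spreads : ∀ {x} → E₁ L B x → ∀ h {X Y} → Img L h B X → Img L h B Y
                     → T (L (flipAt L x X)) → T (L (flipAt L x Y))
  type1-flip-spreads {x} x-type1 h {X} {Y} X∈h[B] Y∈h[B] X△x∈L =
    decidable-stable (T? _) λ Y△x∉L → flip-moves x X (trans (sym (toggle-flips X△x∈L))
      (type1-word-fixes-Img (x-type1 ∷ []) h Y∈h[B]
        (subst (Img L h B) (sym (toggle-stays Y△x∉L)) Y∈h[B]) X∈h[B]))

  type1-type2-flips : ∀ {x y X} → E₁ L B x → E₂ L B y → T (L X)
                    → T (L (flipAt L x X)) → T (L (flipAt L y X)) → T (L (flipAt L x (flipAt L y X)))
  type1-type2-flips {x} {y} {X} x-type1 y-type2 X∈L X△x∈L X△y∈L =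
    type1-flip-spreads x-type1 (reach X) X∈block X△y∈block X△x∈L
    where
    X∈block : Img L (reach X) B X
    X∈block = ∈-Img-reach X∈L
    X△y∈block : Img L (reach X) B (flipAt L y X)
    X△y∈block = subst (Img L (reach X) B) (toggle-flips X△y∈L) (type2-preserves-Img y-type2 (reach X) X∈block)

  toggles-commute : ∀ {x y} → E₁ L B x → E₂ L B y → ∀ {Z} → T (L Z)
                  → toggle L y (toggle L x Z) ≡ toggle L x (toggle L y Z)
  toggles-commute {x} {y} x-type1 y-type2 {Z} Z∈L
    with T? (L (flipAt L x Z)) | T? (L (flipAt L y Z))
  ... | no Z△x∉L | _ = begin
    toggle L y (toggle L x Z)  ≡⟨ cong (toggle L y) (toggle-stays Z△x∉L) ⟩
    toggle L y Z               ≡⟨ sym (toggle-stays τZ△x∉L) ⟩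
    toggle L x (toggle L y Z)  ∎
    where
    Z∈block : Img L (reach Z) B Z
    Z∈block = ∈-Img-reach Z∈L
    τZ△x∉L : ¬ T (L (flipAt L x (toggle L y Z)))
    τZ△x∉L = Z△x∉L ∘ type1-flip-spreads x-type1 (reach Z) (type2-preserves-Img y-type2 (reach Z) Z∈block) Z∈block
  ... | yes Z△x∈L | yes Z△y∈L = begin
    toggle L y (toggle L x Z)      ≡⟨ cong (toggle L y) (toggle-flips Z△x∈L) ⟩
    toggle L y (flipAt L x Z)      ≡⟨ toggle-flips (subst (T ∘ L) flips-commute Z△y△x∈L) ⟩
    flipAt L y (flipAt L x Z)      ≡⟨ sym flips-commute ⟩
    flipAt L x (flipAt L y Z)      ≡⟨ sym (toggle-flips Z△y△x∈L) ⟩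
    toggle L x (flipAt L y Z)      ≡⟨ cong (toggle L x) (sym (toggle-flips Z△y∈L)) ⟩
    toggle L x (toggle L y Z)      ∎
    where
    Z△y△x∈L : T (L (flipAt L x (flipAt L y Z)))
    Z△y△x∈L = type1-type2-flips x-type1 y-type2 Z∈L Z△x∈L Z△y∈L
    flips-commute : flipAt L x (flipAt L y Z) ≡ flipAt L y (flipAt L x Z)
    flips-commute = updateAt-commutes x y (type1≢type2 x-type1 y-type2) Z
  ... | yes Z△x∈L | no Z△y∉L = begin
    toggle L y (toggle L x Z)      ≡⟨ cong (toggle L y) (toggle-flips Z△x∈L) ⟩
    toggle L y (flipAt L x Z)      ≡⟨ toggle-stays Z△x△y∉L ⟩
    flipAt L x Z                   ≡⟨ sym (toggle-flips Z△x∈L) ⟩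
    toggle L x Z                   ≡⟨ cong (toggle L x) (sym (toggle-stays Z△y∉L)) ⟩
    toggle L x (toggle L y Z)      ∎
    where
    W : Subset n
    W = flipAt L x Z
    W△x∈L : T (L (flipAt L x W))
    W△x∈L = subst (T ∘ L) (sym (flip-involutive x Z)) Z∈L
    W△y△x≡Z△y : flipAt L x (flipAt L y W) ≡ flipAt L y Z
    W△y△x≡Z△y = trans (updateAt-commutes x y (type1≢type2 x-type1 y-type2) W)
                       (cong (flipAt L y) (flip-involutive x Z))
    -- W △ x = Z ∈ 𝓛, so W △ y ∈ 𝓛 would put W △ y △ x = Z △ y in 𝓛.
    Z△x△y∉L : ¬ T (L (flipAt L y W))
    Z△x△y∉L W△y∈L =
      Z△y∉L (subst (T ∘ L) W△y△x≡Z△y (type1-type2-flips x-type1 y-type2 Z△x∈L W△x∈L W△y∈L))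

  type1-word-commutes : ∀ {σ y} → All (E₁ L B) σ → E₂ L B y → ∀ {X} → T (L X)
                      → toggle L y (act L σ X) ≡ act L σ (toggle L y X)
  type1-word-commutes {[]}    []                  y-type2 X∈L = refl
  type1-word-commutes {x ∷ σ} (x-type1 ∷ σ-type1) y-type2 X∈L =
    trans (toggles-commute x-type1 y-type2 (act-preserves-L σ X∈L))
          (cong (toggle L x) (type1-word-commutes σ-type1 y-type2 X∈L))

  record Factorisation (X Y : Subset n) : Set where
    field
      word₁ word₂ : List (Fin n)
      word₁-type1 : All (E₁ L B) word₁
      word₂-type2 : All (E₂ L B) word₂
      factors     : act L word₁ (act L word₂ X) ≡ Y

  factorise-word : ∀ g {X} → T (L X) → Factorisation X (act L g X)
  factorise-word []      X∈L = record { word₁ = [] ; word₂ = [] ; word₁-type1 = [] ; word₂-type2 = [] ; factors = refl }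
  factorise-word (e ∷ g) {X} X∈L with type2? e
  ... | yes e-type2 = record
    { word₁       = word₁
    ; word₂       = e ∷ word₂
    ; word₁-type1 = word₁-type1
    ; word₂-type2 = e-type2 ∷ word₂-type2
    ; factors     = trans (sym (type1-word-commutes word₁-type1 e-type2 (act-preserves-L word₂ X∈L)))
                          (cong (toggle L e) factors)
    }
    where
    F : Factorisation X (act L g X)
    F = factorise-word g X∈L
    open Factorisation F
  ... | no e-type1 = record
    { word₁       = e ∷ word₁
    ; word₂       = word₂
    ; word₁-type1 = e-type1 ∷ word₁-type1
    ; word₂-type2 = word₂-type2
    ; factors     = cong (toggle L e) factors
    }
    where
    F : Factorisation X (act L g X)
    F = factorise-word g X∈L
    open Factorisation F

  factorise : ∀ {X Y} → T (L X) → T (L Y) → Factorisation X Y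
  factorise {X} {Y} X∈L Y∈L with L-transitive X Y X∈L Y∈L
  ... | g , refl = factorise-word g X∈L

  type2-word-agrees-on-E₁ : ∀ {σ} → All (E₂ L B) σ → ∀ X → AgreeOn (E₁ L B) (act L σ X) X
  type2-word-agrees-on-E₁ {σ} σ-type2 X e-type1 =
    lookup-act-avoiding σ X (All.map (type1≢type2 e-type1) σ-type2)

  type1-word-agrees-on-E₂ : ∀ {σ} → All (E₁ L B) σ → ∀ X → AgreeOn (E₂ L B) (act L σ X) X
  type1-word-agrees-on-E₂ {σ} σ-type1 X e-type2 =
    lookup-act-avoiding σ X (All.map (λ x-type1 → type1≢type2 x-type1 e-type2 ∘ sym) σ-type1)

  type2-word-preserves-Img : ∀ {σ} → All (E₂ L B) σ → ∀ h {X} → Img L h B X → Img L h B (act L σ X)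
  type2-word-preserves-Img []                  h X∈h[B] = X∈h[B]
  type2-word-preserves-Img (y-type2 ∷ σ-type2) h X∈h[B] =
    type2-preserves-Img y-type2 h (type2-word-preserves-Img σ-type2 h X∈h[B])

  module Midpoint {X Y : Subset n} (F : Factorisation X Y) where
    open Factorisation F

    midpoint : Subset n
    midpoint = act L word₂ X

    midpoint-agrees₁ : AgreeOn (E₁ L B) midpoint X
    midpoint-agrees₁ = type2-word-agrees-on-E₁ word₂-type2 X

    midpoint-agrees₂ : AgreeOn (E₂ L B) midpoint Y
    midpoint-agrees₂ {e} e-type2 =
      trans (sym (type1-word-agrees-on-E₂ word₁-type1 midpoint e-type2)) (cong (λ W → lookup W e) factors)

    midpoint∈L : T (L X) → T (L midpoint)
    midpoint∈L = act-preserves-L word₂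

    midpoint∈Img : ∀ h → Img L h B X → Img L h B midpoint
    midpoint∈Img h = type2-word-preserves-Img word₂-type2 h

    ≡midpoint : ∀ {Z} → AgreeOn (E₁ L B) Z X → AgreeOn (E₂ L B) Z Y → Z ≡ midpoint
    ≡midpoint Z≈X Z≈Y = ≡-from-agreement type2?
      (λ e-type2 → trans (Z≈Y e-type2) (sym (midpoint-agrees₂ e-type2)))
      (λ e-type1 → trans (Z≈X e-type1) (sym (midpoint-agrees₁ e-type1)))

    midpoint≡-same-Img : ∀ h → Img L h B X → Img L h B Y → midpoint ≡ Y
    midpoint≡-same-Img h X∈h[B] Y∈h[B] =
      trans (sym (type1-word-fixes-Img word₁-type1 h midpoint∈h[B]
                   (subst (Img L h B) (sym factors) Y∈h[B]) midpoint∈h[B]))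
            factors
      where
      midpoint∈h[B] : Img L h B midpoint
      midpoint∈h[B] = midpoint∈Img h X∈h[B]

  combine∈L : ∀ {X Y Z} → T (L X) → T (L Y) → AgreeOn (E₁ L B) Z X → AgreeOn (E₂ L B) Z Y → T (L Z)
  combine∈L {X} {Y} X∈L Y∈L Z≈X Z≈Y =
    subst (T ∘ L) (sym (≡midpoint Z≈X Z≈Y)) (midpoint∈L X∈L)
    where
    F : Factorisation X Y
    F = factorise X∈L Y∈L
    open Midpoint F

  agree₁⇒same-Img : ∀ h {X Y} → Img L h B X → T (L Y) → AgreeOn (E₁ L B) Y X → Img L h B Y
  agree₁⇒same-Img h {X} {Y} X∈h[B] Y∈L Y≈X =
    subst (Img L h B) (sym (≡midpoint Y≈X (λ _ → refl))) (midpoint∈Img h X∈h[B])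
    where
    F : Factorisation X Y
    F = factorise (Img⊆L h X∈h[B]) Y∈L
    open Midpoint F

  same-Img⇒agree₁ : ∀ h {X Y} → Img L h B X → Img L h B Y → AgreeOn (E₁ L B) X Y
  same-Img⇒agree₁ h {X} {Y} X∈h[B] Y∈h[B] {e} e-type1 =
    trans (sym (midpoint-agrees₁ e-type1)) (cong (λ W → lookup W e) (midpoint≡-same-Img h X∈h[B] Y∈h[B]))
    where
    F : Factorisation X Y
    F = factorise (Img⊆L h X∈h[B]) (Img⊆L h Y∈h[B])
    open Midpoint F

  module R₁ = Restriction L {P = E₁ L B} (¬? ∘ type2?)
  module R₂ = Restriction L type2?

  merge : Subset n → Subset n → Subset n
  merge X Y = R₁.restrict X ∪ R₂.restrict Y

  merge-agrees₁ : ∀ X Y → AgreeOn (E₁ L B) (merge X Y) X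
  merge-agrees₁ X Y {e} e-type1 = begin
    lookup (merge X Y) e                                ≡⟨ lookup-∪ (R₁.restrict X) (R₂.restrict Y) e ⟩
    lookup (R₁.restrict X) e ∨ lookup (R₂.restrict Y) e ≡⟨ cong₂ _∨_ (R₁.restrict-agrees X e-type1) (R₂.restrict-outside Y e-type1) ⟩
    lookup X e ∨ false                                  ≡⟨ ∨-identityʳ _ ⟩
    lookup X e                                          ∎

  merge-agrees₂ : ∀ X Y → AgreeOn (E₂ L B) (merge X Y) Y
  merge-agrees₂ X Y {e} e-type2 = begin
    lookup (merge X Y) e                                ≡⟨ lookup-∪ (R₁.restrict X) (R₂.restrict Y) e ⟩
    lookup (R₁.restrict X) e ∨ lookup (R₂.restrict Y) e ≡⟨ cong₂ _∨_ (R₁.restrict-outside X (λ e-type1 → e-type1 e-type2)) (R₂.restrict-agrees Y e-type2) ⟩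
    false ∨ lookup Y e                                  ≡⟨⟩
    lookup Y e                                          ∎

  merge-self : ∀ X → merge X X ≡ X
  merge-self X = ≡-from-agreement type2? (merge-agrees₂ X X) (merge-agrees₁ X X)

  product : IsProduct L (Proj L (E₁ L B)) (Proj L (E₂ L B))
  product X =
      (λ X∈L → R₁.restrict X , R₂.restrict X , R₁.restrict∈Proj X∈L , R₂.restrict∈Proj X∈L
             , sym (merge-self X))
    , (λ { (X₁ , X₂ , (A₁ , A₁∈L , r₁) , (A₂ , A₂∈L , r₂) , refl) →
           subst (T ∘ L) (sym (cong₂ _∪_ (R₁.Restr⇒≡restrict r₁) (R₂.Restr⇒≡restrict r₂)))
             (combine∈L A₁∈L A₂∈L (merge-agrees₁ A₁ A₂) (merge-agrees₂ A₁ A₂)) })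

  merge∈Img : ∀ h {Z Y} → Img L h B Z → Proj L (E₂ L B) Y → Img L h B (merge Z Y)
  merge∈Img h {Z} {Y} Z∈h[B] (A , A∈L , r) =
    agree₁⇒same-Img h Z∈h[B] (combine∈L (Img⊆L h Z∈h[B]) A∈L (merge-agrees₁ Z Y) merge≈A) (merge-agrees₁ Z Y)
    where
    merge≈A : AgreeOn (E₂ L B) (merge Z Y) A
    merge≈A {e} e-type2 = trans (merge-agrees₂ Z Y e-type2)
      (trans (cong (λ W → lookup W e) (R₂.Restr⇒≡restrict r)) (R₂.restrict-agrees A e-type2))

  merge-restrict₂-same-Img : ∀ h {Z X} → Img L h B Z → Img L h B X → merge Z (R₂.restrict X) ≡ X
  merge-restrict₂-same-Img h {Z} {X} Z∈h[B] X∈h[B] = ≡-from-agreement type2?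
    (λ e-type2 → trans (merge-agrees₂ Z (R₂.restrict X) e-type2) (R₂.restrict-agrees X e-type2))
    (λ e-type1 → trans (merge-agrees₁ Z (R₂.restrict X) e-type1) (same-Img⇒agree₁ h Z∈h[B] X∈h[B] e-type1))

  merge-injective : ∀ Z {Y Y′} → Proj L (E₂ L B) Y → Proj L (E₂ L B) Y′ → merge Z Y ≡ merge Z Y′ → Y ≡ Y′
  merge-injective Z {Y} {Y′} Y∈L₂ Y′∈L₂ eq = ≡-from-agreement type2?
    (λ {e} e-type2 → trans (sym (merge-agrees₂ Z Y e-type2))
                           (trans (cong (λ W → lookup W e) eq) (merge-agrees₂ Z Y′ e-type2)))
    (λ e-type1 → trans (R₂.Proj-outside Y∈L₂ e-type1) (sym (R₂.Proj-outside Y′∈L₂ e-type1)))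

  block-count : Σ ℕ λ m → NumBlocks L B m × HasSize (Proj L (E₁ L B)) m
  block-count with decidable⇒HasSize R₁.Proj?
  ... | m , size@(v , v-inj , v-enum) = m , (hs , hs-distinct , hs-cover) , size
    where
    v∈L₁ : ∀ i → Proj L (E₁ L B) (lookup v i)
    v∈L₁ i = proj₂ (v-enum (lookup v i)) (i , refl)
    rep : Fin m → Subset n
    rep i = proj₁ (v∈L₁ i)
    rep∈L : ∀ i → T (L (rep i))
    rep∈L i = proj₁ (proj₂ (v∈L₁ i))
    v≡restrict-rep : ∀ i → lookup v i ≡ R₁.restrict (rep i)
    v≡restrict-rep i = R₁.Restr⇒≡restrict (proj₂ (proj₂ (v∈L₁ i)))
    hs : Vec (List (Fin n)) m
    hs = tabulate (reach ∘ rep)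
    rep∈hs : ∀ i → Img L (lookup hs i) B (rep i)
    rep∈hs i = subst (λ h → Img L h B (rep i)) (sym (lookup∘tabulate (reach ∘ rep) i)) (∈-Img-reach (rep∈L i))
    hs-distinct : ∀ i j → SetEq L (Img L (lookup hs i) B) (Img L (lookup hs j) B) → i ≡ j
    hs-distinct i j hs[i]≡hs[j] = v-inj i j (trans (v≡restrict-rep i) (trans
      (R₁.restrict-cong (same-Img⇒agree₁ (lookup hs i) (rep∈hs i) (proj₂ (hs[i]≡hs[j] (rep j)) (rep∈hs j))))
      (sym (v≡restrict-rep j))))
    hs-cover : ∀ h → Σ (Fin m) λ i → SetEq L (Img L h B) (Img L (lookup hs i) B)
    hs-cover h with proj₁ (v-enum (R₁.restrict (act L h base))) (R₁.restrict∈Proj (Img⊆L h (base∈Img h)))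
    ... | i , v[i]≡restrict-base = i , images-meet⇒SetEq h (lookup hs i) (base∈Img h)
      (agree₁⇒same-Img (lookup hs i) (rep∈hs i) (Img⊆L h (base∈Img h))
        (R₁.restrict-≡⇒agree (trans (sym v[i]≡restrict-base) (v≡restrict-rep i))))

  block-size : Σ ℕ λ k → HasSize (Proj L (E₂ L B)) k × (∀ h → HasSize (Img L h B) k)
  block-size with decidable⇒HasSize R₂.Proj?
  ... | k , size = k , size , λ h → HasSize-map (merge (act L h base))
    (merge∈Img h (base∈Img h))
    (λ {X} X∈h[B] → R₂.restrict X , R₂.restrict∈Proj (Img⊆L h X∈h[B])
                  , merge-restrict₂-same-Img h (base∈Img h) X∈h[B])
    (merge-injective (act L h base))
    size

lemma2p6 : (n : ℕ) (L : Family n) (B : Coll n)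
    → (∀ e → NontrivialToggle L e)
    → Transitive L
    → IsBlock L B
    → (∀ (σ : List (Fin n)) → All (λ e → Type1 L B [ e ]) σ
         → ∀ h → SetEq L (Img L σ (Img L h B)) (Img L h B)
         → ∀ A → Img L h B A → act L σ A ≡ A)
    → IsProduct L (Proj L (E₁ L B)) (Proj L (E₂ L B))
      × (Σ ℕ λ m → NumBlocks L B m × HasSize (Proj L (E₁ L B)) m)
      × (Σ ℕ λ k → HasSize (Proj L (E₂ L B)) k × (∀ h → HasSize (Img L h B) k))
-- The convention that no toggle is the identity is not needed.
lemma2p6 n L B _ L-transitive B-block type1-stabiliser-fixes = product , block-count , block-size
  where open TypeSplit L B L-transitive B-block type1-stabiliser-fixes
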